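{- For every integer $n\ge 0$ let $T_n=[x^n](1+x+x^2)^n=\sum_{l=0}^{\lfloor n/2\rfloor}\binom{n}{2l}\binom{2l}{l}$ be the $n$-th central trinomial coefficient. Then for every prime $p>3$, \[ \sum_{k=0}^{p-1}k(k+1)(8k+9)T_kT_{k+1}\equiv -p^2\left(\frac{53}{12}+\frac{21}{4}\left(\frac{p}{3}\right)\right)\pmod{p^3}. \]
   Context: $\left(\frac{p}{3}\right)$ is the Legendre symbol. A congruence between rational numbers whose denominators are coprime to $p$ means that their difference, as an element of the localization $\mathbb{Z}_{(p)}$, lies in $p^3\mathbb{Z}_{(p)}$. -}

module Defs where

open import Data.Nat using (ℕ; zero; suc; _+_; _*_; _/_; _%_; _^_)
open import Data.Nat.Combinatorics using (_C_)
open import Data.Nat.Divisibility using (_∣_)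
open import Data.Integer as ℤ using (ℤ; +_; -[1+_])
open import Data.Rational as ℚ using (ℚ)
open import Data.Product using (∃-syntax; _×_)
open import Relation.Nullary using (¬_)
open import Relation.Binary.PropositionalEquality using (_≡_)

sumTo : ℕ → (ℕ → ℕ) → ℕ
sumTo zero    f = f 0
sumTo (suc n) f = sumTo n f + f (suc n)

T : ℕ → ℕ
T n = sumTo (n / 2) (λ l → (n C (2 * l)) * ((2 * l) C l))

legendre3 : ℕ → ℤ
legendre3 a with a % 3
... | 0 = + 0
... | 1 = + 1
... | _ = -[1+ 0 ]

toℚ : ℤ → ℚ
toℚ z = z ℚ./ 1

-- x ≡ y (mod p^3) in ℤ_(p): x - y = p^3 a / b with a ∈ ℤ, b ∈ ℕ, p ∤ b
CongModP3 : ℕ → ℚ → ℚ → Set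
CongModP3 p x y =
  ∃[ a ] ∃[ b ] (¬ (p ∣ b)) × (toℚ (+ b) ℚ.* (x ℚ.- y) ≡ toℚ (+ (p ^ 3) ℤ.* a))

{-# OPTIONS --safe #-}
module Submission where

-- Write cₖ for the coefficient of xᵏ in (1 + x + x²)ⁿ, so that Tₙ = cₙ.  Comparing
-- coefficients in (1 + x + x²) f′ = n (1 + 2x) f gives a three-term recurrence in k,
-- hence the symmetry cₙ₊₁ = cₙ₋₁ and the recurrence
-- (n + 2) Tₙ₊₂ = (2n + 3) Tₙ₊₁ + 3 (n + 1) Tₙ.  With it the sum telescopes:
-- 24 Σ_{k<n} k (k + 1) (8k + 9) Tₖ Tₖ₊₁ = Q(n, n Tₙ, n Tₙ₋₁) for the quadratic form
-- Q(n, X, Y) = -(2n - 5)² X² + (24n² + 120n - 126) X Y - 9 (2n - 3)² Y².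
-- For n = p the right side is p² Q(p, Tₚ, Tₚ₋₁), so Tₚ and Tₚ₋₁ are only needed
-- modulo p.  Since (1 + x + x²)ᵖ ≡ 1 + xᵖ + x²ᵖ, the coefficients of (1 + x + x²)ᵖ⁻¹
-- below degree p agree modulo p with those of 1 / (1 + x + x²) = (1 - x) / (1 - x³),
-- which gives Tₚ₋₁ ≡ (p/3) and Tₚ ≡ 1.  Hence 24 Σ ≡ p² Q(0, 1, (p/3))
-- = -p² (106 + 126 (p/3)) (mod p³), and 24 is a unit modulo p.

open import Defs

module Trinomial where
  open import Data.Nat as ℕ using (ℕ; zero; suc)
  import Data.Nat.Properties as ℕ
  open import Data.Integer using (ℤ; +_; _+_; _-_; _*_)
  open import Data.Integer.Properties using (i-j≡0⇒i≡j; *-cancelˡ-≡)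
  open import Data.Integer.Divisibility.Signed using (_∣_; divides; ∣-refl; ∣m∣n⇒∣m+n; ∣m∣n⇒∣m-n; ∣m⇒∣m*n)
  open import Data.Integer.Tactic.RingSolver using (solve-∀)
  open import Relation.Binary.PropositionalEquality using (_≡_; refl; sym; trans; cong; cong₂; subst; module ≡-Reasoning)

  -- tri n (2 + k) is the coefficient of xᵏ in (1 + x + x²)ⁿ; the two padding
  -- zeros in front make Pascal's rule below hold without boundary cases.
  tri : ℕ → ℕ → ℤ
  tri n       0                   = + 0
  tri n       1                   = + 0
  tri zero    2                   = + 1
  tri zero    (suc (suc (suc k))) = + 0
  tri (suc n) (suc (suc k))       = tri n (suc (suc k)) + tri n (suc k) + tri n k

  central : ℕ → ℤ
  central n = tri n (suc (suc n))

  tri-constant : ∀ n → tri n 2 ≡ + 1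
  tri-constant zero    = refl
  tri-constant (suc n) = cong (λ c → c + + 0 + + 0) (tri-constant n)

  tri-linear : ∀ n → tri n 3 ≡ + n
  tri-linear zero = refl
  tri-linear (suc n) rewrite tri-linear n | tri-constant n =
    cong +_ (trans (ℕ.+-identityʳ (n ℕ.+ 1)) (ℕ.+-comm n 1))

  -- Comparing coefficients of xⁱ⁻¹ in (1 + x + x²) f′ = n (1 + 2x) f for f = (1 + x + x²)ⁿ
  -- gives i cᵢ = (n + 1 - i) cᵢ₋₁ + (2n + 2 - i) cᵢ₋₂.
  defect : ℤ → ℤ → ℤ → ℤ → ℤ → ℤ
  defect n i c₂ c₁ c₀ = i * c₂ - ((+ 1 + n - i) * c₁ + (+ 2 + + 2 * n - i) * c₀)
  -- INLINE makes defect transparent to solve-∀, which treats other definitions as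
  -- opaque constants.
  {-# INLINE defect #-}

  defect-pascal : ∀ n j a₀ a₁ a₂ a₃ a₄ →
    defect (+ 1 + n) (+ 2 + j) (a₄ + a₃ + a₂) (a₃ + a₂ + a₁) (a₂ + a₁ + a₀)
      ≡ defect n (+ 2 + j) a₄ a₃ a₂ + defect n (+ 1 + j) a₃ a₂ a₁ + defect n j a₂ a₁ a₀
  defect-pascal = solve-∀

  tri-defect : ℕ → ℕ → ℤ
  tri-defect n i = defect (+ n) (+ i) (tri n (2 ℕ.+ i)) (tri n (1 ℕ.+ i)) (tri n i)

  tri-defect≡0 : ∀ n i → tri-defect n i ≡ + 0
  tri-defect≡0 n 0 = vanishes (tri n 2) (+ 1 + + n - + 0) (+ 2 + + 2 * + n - + 0)
    where
    vanishes : ∀ a b c → + 0 * a - (b * + 0 + c * + 0) ≡ + 0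
    vanishes = solve-∀
  tri-defect≡0 n 1 rewrite tri-linear n | tri-constant n = vanishes (+ n) (+ 2 + + 2 * + n - + 1)
    where
    vanishes : ∀ n c → + 1 * n - ((+ 1 + n - + 1) * + 1 + c * + 0) ≡ + 0
    vanishes = solve-∀
  tri-defect≡0 zero 2 = refl
  tri-defect≡0 zero (suc (suc (suc j))) = vanishes (+ (3 ℕ.+ j)) (+ 1 + + 0 - + (3 ℕ.+ j)) (+ 2 + + 2 * + 0 - + (3 ℕ.+ j))
    where
    vanishes : ∀ a b c → a * + 0 - (b * + 0 + c * + 0) ≡ + 0
    vanishes = solve-∀
  tri-defect≡0 (suc n) (suc (suc j)) = begin
    tri-defect (suc n) (2 ℕ.+ j)
      ≡⟨ defect-pascal (+ n) (+ j) (tri n j) (tri n (1 ℕ.+ j)) (tri n (2 ℕ.+ j)) (tri n (3 ℕ.+ j)) (tri n (4 ℕ.+ j)) ⟩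
    tri-defect n (2 ℕ.+ j) + tri-defect n (1 ℕ.+ j) + tri-defect n j
      ≡⟨ cong₂ _+_ (cong₂ _+_ (tri-defect≡0 n (2 ℕ.+ j)) (tri-defect≡0 n (1 ℕ.+ j))) (tri-defect≡0 n j) ⟩
    + 0                                                                 ∎
    where open ≡-Reasoning

  tri-recurrence : ∀ n i → + i * tri n (2 ℕ.+ i)
    ≡ (+ 1 + + n - + i) * tri n (1 ℕ.+ i) + (+ 2 + + 2 * + n - + i) * tri n i
  tri-recurrence n i = i-j≡0⇒i≡j _ _ (tri-defect≡0 n i)

  tri-symmetric : ∀ n → tri n (3 ℕ.+ n) ≡ tri n (1 ℕ.+ n)
  tri-symmetric n = *-cancelˡ-≡ (+ suc n) _ _ (trans (tri-recurrence n (1 ℕ.+ n))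
    (vanishing-middle (+ n) (tri n (2 ℕ.+ n)) (tri n (1 ℕ.+ n))))
    where
    vanishing-middle : ∀ n a b → (+ 1 + n - (+ 1 + n)) * a + (+ 2 + + 2 * n - (+ 1 + n)) * b ≡ (+ 1 + n) * b
    vanishing-middle = solve-∀

  central-suc : ∀ n → central (suc n) ≡ tri n (1 ℕ.+ n) + central n + tri n (1 ℕ.+ n)
  central-suc n = cong (λ c → c + central n + tri n (1 ℕ.+ n)) (tri-symmetric n)

  central-recurrence : ∀ n → + (2 ℕ.+ n) * central (2 ℕ.+ n)
    ≡ (+ 3 + + 2 * + n) * central (1 ℕ.+ n) + + 3 * + (1 ℕ.+ n) * central n
  central-recurrence n = begin
    + (2 ℕ.+ n) * central (2 ℕ.+ n)               ≡⟨ cong (+ (2 ℕ.+ n) *_) (central-suc (suc n)) ⟩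
    + (2 ℕ.+ n) * (d + central (1 ℕ.+ n) + d)     ≡⟨ cong (λ c → + (2 ℕ.+ n) * (d + c + d)) (central-suc n) ⟩
    + (2 ℕ.+ n) * (d + (b + a + b) + d)           ≡⟨ identity (+ n) a b c ⟩
    rhs (b + a + b) + + 2 * (r - + n * a)         ≡⟨ cong (λ x → rhs (b + a + b) + + 2 * (r - x)) (tri-recurrence n n) ⟩
    rhs (b + a + b) + + 2 * (r - r)               ≡⟨ cancel (rhs (b + a + b)) r ⟩
    rhs (b + a + b)                               ≡⟨ cong rhs (central-suc n) ⟨
    rhs (central (1 ℕ.+ n))                       ∎
    where
    open ≡-Reasoning
    a = central n
    b = tri n (1 ℕ.+ n)
    c = tri n n
    d = tri (suc n) (2 ℕ.+ n)
    r = (+ 1 + + n - + n) * b + (+ 2 + + 2 * + n - + n) * c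
    rhs : ℤ → ℤ
    rhs x = (+ 3 + + 2 * + n) * x + + 3 * + (1 ℕ.+ n) * a
    identity : ∀ n a b c → (+ 2 + n) * ((a + b + c) + (b + a + b) + (a + b + c))
      ≡ (+ 3 + + 2 * n) * (b + a + b) + + 3 * (+ 1 + n) * a
        + + 2 * (((+ 1 + n - n) * b + (+ 2 + + 2 * n - n) * c) - n * a)
    identity = solve-∀
    cancel : ∀ x r → x + + 2 * (r - r) ≡ x
    cancel = solve-∀

  -- (i - 2) · tri n i is the coefficient of xⁱ⁻³ in n (1 + 2x) (1 + x + x²)ⁿ⁻¹.
  n∣[i-2]*tri : ∀ n i → + n ∣ (+ i - + 2) * tri n i
  n∣[i-2]*tri n 0 = divides (+ 0) refl
  n∣[i-2]*tri n 1 = divides (+ 0) refl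
  n∣[i-2]*tri n (suc (suc j)) = subst (+ n ∣_) (sym by-recurrence)
    (∣m∣n⇒∣m-n (∣m⇒∣m*n (tri n (1 ℕ.+ j) + + 2 * tri n j) ∣-refl)
               (∣m∣n⇒∣m+n (n∣[i-2]*tri n (suc j)) (n∣[i-2]*tri n j)))
    where
    open ≡-Reasoning
    by-recurrence : (+ (2 ℕ.+ j) - + 2) * tri n (2 ℕ.+ j)
      ≡ + n * (tri n (1 ℕ.+ j) + + 2 * tri n j) - ((+ (1 ℕ.+ j) - + 2) * tri n (1 ℕ.+ j) + (+ j - + 2) * tri n j)
    by-recurrence = begin
      (+ (2 ℕ.+ j) - + 2) * tri n (2 ℕ.+ j)   ≡⟨ cong (_* tri n (2 ℕ.+ j)) (shift (+ j)) ⟩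
      + j * tri n (2 ℕ.+ j)                   ≡⟨ tri-recurrence n j ⟩
      (+ 1 + + n - + j) * tri n (1 ℕ.+ j) + (+ 2 + + 2 * + n - + j) * tri n j
                                              ≡⟨ regroup (+ n) (+ j) (tri n (1 ℕ.+ j)) (tri n j) ⟩
      _                                       ∎
      where
      shift : ∀ j → (+ 2 + j) - + 2 ≡ j
      shift = solve-∀
      regroup : ∀ n j a b → (+ 1 + n - j) * a + (+ 2 + + 2 * n - j) * b
        ≡ n * (a + + 2 * b) - (((+ 1 + j) - + 2) * a + (j - + 2) * b)
      regroup = solve-∀

module TrinomialModPrime where
  open import Data.Nat as ℕ using (ℕ; zero; suc; _≤_; _<_)
  import Data.Nat.Properties as ℕ
  open import Data.Nat.Divisibility as ℕ using (>⇒∤)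
  open import Data.Nat.DivMod using (_%_; _/_; m≡m%n+[m/n]*n)
  open import Data.Nat.Primality using (Prime; euclidsLemma)
  import Data.Nat.Tactic.RingSolver as ℕ-Ring
  open import Data.Integer using (ℤ; ∣_∣; +_; -_; _+_; _-_; _*_)
  open import Data.Integer.Properties using (+-identityʳ; abs-*)
  open import Data.Integer.Divisibility.Signed using (_∣_; divides; ∣⇒∣ᵤ; ∣ᵤ⇒∣; ∣m∣n⇒∣m+n; ∣m∣n⇒∣m-n; ∣n⇒∣m*n)
  open import Data.Integer.Tactic.RingSolver using (solve-∀)
  open import Data.Product using (_×_; _,_)
  open import Data.Sum using (_⊎_; inj₁; inj₂; [_,_]′)
  open import Relation.Nullary using (contradiction)
  open import Relation.Binary.PropositionalEquality using (_≡_; refl; sym; trans; cong; subst; module ≡-Reasoning)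
  open Trinomial

  p∣j*x⇒p∣x : ∀ {p} j x → Prime p → suc j < p → + p ∣ + suc j * x → + p ∣ x
  p∣j*x⇒p∣x {p} j x prime-p j<p p∣jx =
    [ (λ p∣j → contradiction p∣j (>⇒∤ j<p)) , ∣ᵤ⇒∣ ]′
      (euclidsLemma (suc j) ∣ x ∣ prime-p (subst (p ℕ.∣_) (abs-* (+ suc j) x) (∣⇒∣ᵤ p∣jx)))

  p∣tri[p] : ∀ {p} j → Prime p → suc j < p → + p ∣ tri p (3 ℕ.+ j)
  p∣tri[p] {p} j prime-p j<p = p∣j*x⇒p∣x j (tri p (3 ℕ.+ j)) prime-p j<p (n∣[i-2]*tri p (3 ℕ.+ j))

  -- χ (2 + k) is the coefficient of xᵏ in 1 / (1 + x + x²) = (1 - x) / (1 - x³), indexed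
  -- like tri; χ 0 = -1 (instead of a padding zero) keeps χ 3-periodic.
  χ : ℕ → ℤ
  χ 0                     = - + 1
  χ 1                     = + 0
  χ 2                     = + 1
  χ (suc (suc (suc i)))   = χ i

  χ-recurrence : ∀ i → χ (2 ℕ.+ i) + χ (1 ℕ.+ i) + χ i ≡ + 0
  χ-recurrence 0                     = refl
  χ-recurrence 1                     = refl
  χ-recurrence 2                     = refl
  χ-recurrence (suc (suc (suc i)))   = χ-recurrence i

  χ-periodic : ∀ q i → χ (q ℕ.* 3 ℕ.+ i) ≡ χ i
  χ-periodic zero    i = refl
  χ-periodic (suc q) i = χ-periodic q i

  χ-mod3 : ∀ i p → χ (i ℕ.+ p) ≡ χ (i ℕ.+ p % 3)
  χ-mod3 i p = begin
    χ (i ℕ.+ p)                            ≡⟨ cong (λ m → χ (i ℕ.+ m)) (m≡m%n+[m/n]*n p 3) ⟩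
    χ (i ℕ.+ (p % 3 ℕ.+ p / 3 ℕ.* 3))      ≡⟨ cong χ (regroup i (p % 3) (p / 3 ℕ.* 3)) ⟩
    χ (p / 3 ℕ.* 3 ℕ.+ (i ℕ.+ p % 3))      ≡⟨ χ-periodic (p / 3) (i ℕ.+ p % 3) ⟩
    χ (i ℕ.+ p % 3)                        ∎
    where
    open ≡-Reasoning
    regroup : ∀ i r k → i ℕ.+ (r ℕ.+ k) ≡ k ℕ.+ (i ℕ.+ r)
    regroup = ℕ-Ring.solve-∀

  χ-legendre3 : ∀ p → p % 3 ≡ 1 ⊎ p % 3 ≡ 2 → χ (1 ℕ.+ p) ≡ legendre3 p × + 2 * χ p + χ (1 ℕ.+ p) ≡ + 1
  χ-legendre3 p residue rewrite χ-mod3 0 p | χ-mod3 1 p with residue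
  ... | inj₁ p≡1 rewrite p≡1 = refl , refl
  ... | inj₂ p≡2 rewrite p≡2 = refl , refl

  -- Modulo p, (1 + x + x²)ᵖ⁻¹ agrees with 1 / (1 + x + x²) below degree p, because
  -- (1 + x + x²)ᵖ ≡ 1 + xᵖ + x²ᵖ.
  p∣tri[p-1]-χ : ∀ {N} → Prime (suc N) → ∀ k → k ≤ suc N → + suc N ∣ tri N (suc k) - χ (suc k)
  p∣tri[p-1]-χ prime-p 0 _ = divides (+ 0) refl
  p∣tri[p-1]-χ {N} prime-p 1 _ = divides (+ 0) (cong (_- + 1) (tri-constant N))
  p∣tri[p-1]-χ {N} prime-p (suc (suc k)) k≤N = subst (+ suc N ∣_) pascal
    (∣m∣n⇒∣m-n (∣m∣n⇒∣m-n (p∣tri[p] k prime-p k≤N)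
      (p∣tri[p-1]-χ prime-p (suc k) (ℕ.<⇒≤ k≤N)))
      (p∣tri[p-1]-χ prime-p k (ℕ.≤-trans (ℕ.n≤1+n k) (ℕ.<⇒≤ k≤N))))
    where
    open ≡-Reasoning
    t = tri N
    pascal : (t (3 ℕ.+ k) + t (2 ℕ.+ k) + t (1 ℕ.+ k)) - (t (2 ℕ.+ k) - χ (2 ℕ.+ k)) - (t (1 ℕ.+ k) - χ (1 ℕ.+ k))
      ≡ t (3 ℕ.+ k) - χ (3 ℕ.+ k)
    pascal = begin
      _                                                       ≡⟨ regroup (t (3 ℕ.+ k)) (t (2 ℕ.+ k)) (t (1 ℕ.+ k)) (χ (3 ℕ.+ k)) (χ (2 ℕ.+ k)) (χ (1 ℕ.+ k)) ⟩
      t (3 ℕ.+ k) - χ (3 ℕ.+ k) + (χ (3 ℕ.+ k) + χ (2 ℕ.+ k) + χ (1 ℕ.+ k))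
                                                              ≡⟨ cong (_+_ (t (3 ℕ.+ k) - χ (3 ℕ.+ k))) (χ-recurrence (suc k)) ⟩
      t (3 ℕ.+ k) - χ (3 ℕ.+ k) + + 0                         ≡⟨ +-identityʳ _ ⟩
      t (3 ℕ.+ k) - χ (3 ℕ.+ k)                               ∎
      where
      regroup : ∀ a₃ a₂ a₁ c₃ c₂ c₁ → (a₃ + a₂ + a₁) - (a₂ - c₂) - (a₁ - c₁) ≡ a₃ - c₃ + (c₃ + c₂ + c₁)
      regroup = solve-∀

  p∣central[p-1]-χ : ∀ {N} → Prime (suc N) → + suc N ∣ central N - χ (2 ℕ.+ N)
  p∣central[p-1]-χ prime-p = p∣tri[p-1]-χ prime-p _ ℕ.≤-refl

  p∣central[p]-χ : ∀ {N} → Prime (suc N) → + suc N ∣ central (suc N) - (+ 2 * χ (1 ℕ.+ N) + χ (2 ℕ.+ N))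
  p∣central[p]-χ {N} prime-p = subst (+ suc N ∣_) (sym (trans (cong (_- (+ 2 * c₁ + c₂)) (central-suc N)) (regroup b a c₁ c₂)))
    (∣m∣n⇒∣m+n (∣n⇒∣m*n (+ 2) (p∣tri[p-1]-χ prime-p N (ℕ.n≤1+n N))) (p∣central[p-1]-χ prime-p))
    where
    a = central N
    b = tri N (1 ℕ.+ N)
    c₁ = χ (1 ℕ.+ N)
    c₂ = χ (2 ℕ.+ N)
    regroup : ∀ b a c₁ c₂ → (b + a + b) - (+ 2 * c₁ + c₂) ≡ + 2 * (b - c₁) + (a - c₂)
    regroup = solve-∀

module CentralTrinomialSum where
  open import Data.Nat
  open import Data.Nat.Properties
  open import Algebra.Properties.CommutativeSemigroup +-commutativeSemigroup using (interchange; xy∙z≈xz∙y)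
  open import Data.Nat.Combinatorics using (_C_; k>n⇒nCk≡0; nCk≡nC[n∸k]; nCk+nC[k+1]≡[n+1]C[k+1])
  open import Data.Nat.DivMod using (_/_; m/n≤m; m*n/n≡m; /-monoˡ-≤)
  import Data.Nat.Tactic.RingSolver as ℕ-Ring
  open import Data.Integer as ℤ using (+_)
  import Data.Integer.Properties as ℤ
  open import Function using (_∘_)
  open import Relation.Binary.PropositionalEquality using (_≡_; refl; sym; trans; cong; cong₂; subst; module ≡-Reasoning)
  open import Relation.Nullary using (yes; no)
  open Trinomial using (tri; central; central-suc)

  sumTo-cong : ∀ n {f g : ℕ → ℕ} → (∀ j → f j ≡ g j) → sumTo n f ≡ sumTo n g
  sumTo-cong zero    f≡g = f≡g 0
  sumTo-cong (suc n) f≡g = cong₂ _+_ (sumTo-cong n f≡g) (f≡g (suc n))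

  sumTo-zero : ∀ n {f : ℕ → ℕ} → (∀ j → f j ≡ 0) → sumTo n f ≡ 0
  sumTo-zero n f≡0 = trans (sumTo-cong n f≡0) (zeros n)
    where
    zeros : ∀ n → sumTo n (λ _ → 0) ≡ 0
    zeros zero    = refl
    zeros (suc n) = cong (_+ 0) (zeros n)

  sumTo-+ : ∀ n (f g : ℕ → ℕ) → sumTo n (λ j → f j + g j) ≡ sumTo n f + sumTo n g
  sumTo-+ zero    f g = refl
  sumTo-+ (suc n) f g = trans (cong (_+ (f (suc n) + g (suc n))) (sumTo-+ n f g))
    (interchange (sumTo n f) (sumTo n g) (f (suc n)) (g (suc n)))

  sumTo-* : ∀ n c (f : ℕ → ℕ) → sumTo n (λ j → c * f j) ≡ c * sumTo n f
  sumTo-* zero    c f = refl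
  sumTo-* (suc n) c f = trans (cong (_+ c * f (suc n)) (sumTo-* n c f)) (sym (*-distribˡ-+ c (sumTo n f) (f (suc n))))

  sumTo-head : ∀ n (f : ℕ → ℕ) → sumTo (suc n) f ≡ f 0 + sumTo n (f ∘ suc)
  sumTo-head zero    f = refl
  sumTo-head (suc n) f = trans (cong (_+ f (2 + n)) (sumTo-head n f)) (+-assoc (f 0) _ _)

  sumTo-extend : ∀ k n (f : ℕ → ℕ) → (∀ j → n < j → f j ≡ 0) → sumTo (k + n) f ≡ sumTo n f
  sumTo-extend zero    n f vanish = refl
  sumTo-extend (suc k) n f vanish =
    trans (cong (_+_ (sumTo (k + n) f)) (vanish (suc (k + n)) (s≤s (m≤n+m n k))))
          (trans (+-identityʳ _) (sumTo-extend k n f vanish))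

  -- j factors contribute 1, m + j contribute x² and the remaining ones x, so summing
  -- over j gives the coefficient of xⁿ⁺ᵐ in (1 + x + x²)ⁿ.
  trinomialTerm : ℕ → ℕ → ℕ → ℕ
  trinomialTerm n m j = (n C (m + 2 * j)) * ((m + 2 * j) C j)

  trinomialSum : ℕ → ℕ → ℕ
  trinomialSum n m = sumTo n (trinomialTerm n m)

  trinomialTerm-vanish : ∀ {n} m j → n < m + 2 * j → trinomialTerm n m j ≡ 0
  trinomialTerm-vanish m j n<m+2j rewrite k>n⇒nCk≡0 n<m+2j = refl

  trinomialSum-vanish : ∀ {n m} → n < m → trinomialSum n m ≡ 0
  trinomialSum-vanish {n} {m} n<m = sumTo-zero n (λ j → trinomialTerm-vanish m j (≤-trans n<m (m≤m+n m (2 * j))))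

  trinomialSum-suc : ∀ n m → sumTo (suc n) (trinomialTerm n m) ≡ trinomialSum n m
  trinomialSum-suc n m = trans (cong (_+_ (trinomialSum n m)) last≡0) (+-identityʳ _)
    where
    last≡0 : trinomialTerm n m (suc n) ≡ 0
    last≡0 = trinomialTerm-vanish m (suc n) (≤-trans (m≤m+n (suc n) (suc n + 0)) (m≤n+m (2 * suc n) m))

  pascal : ∀ n k → suc n C suc k ≡ n C k + n C suc k
  pascal n k = sym (nCk+nC[k+1]≡[n+1]C[k+1] n k)

  trinomialSum-pascal : ∀ n m → trinomialSum (suc n) (suc m) ≡ trinomialSum n m + trinomialSum n (suc m) + trinomialSum n (2 + m)
  trinomialSum-pascal n m = begin
    trinomialSum (suc n) (suc m)
      ≡⟨ sumTo-cong (suc n) (λ j → cong (_* (suc (m + 2 * j) C j)) (pascal n (m + 2 * j))) ⟩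
    sumTo (suc n) (λ j → (n C (m + 2 * j) + n C suc (m + 2 * j)) * (suc (m + 2 * j) C j))
      ≡⟨ sumTo-cong (suc n) (λ j → *-distribʳ-+ (suc (m + 2 * j) C j) (n C (m + 2 * j)) _) ⟩
    sumTo (suc n) (λ j → g j + trinomialTerm n (suc m) j)
      ≡⟨ sumTo-+ (suc n) g (trinomialTerm n (suc m)) ⟩
    sumTo (suc n) g + sumTo (suc n) (trinomialTerm n (suc m))
      ≡⟨ cong₂ _+_ g-sum (trinomialSum-suc n (suc m)) ⟩
    trinomialSum n m + trinomialSum n (2 + m) + trinomialSum n (suc m)
      ≡⟨ xy∙z≈xz∙y (trinomialSum n m) _ _ ⟩
    trinomialSum n m + trinomialSum n (suc m) + trinomialSum n (2 + m) ∎
    where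
    open ≡-Reasoning
    g : ℕ → ℕ
    g j = (n C (m + 2 * j)) * (suc (m + 2 * j) C j)
    g-suc : ∀ j → g (suc j) ≡ trinomialTerm n m (suc j) + trinomialTerm n (2 + m) j
    g-suc j = begin
      (n C X) * (suc X C suc j)                     ≡⟨ cong (_*_ (n C X)) (pascal X j) ⟩
      (n C X) * (X C j + X C suc j)                 ≡⟨ *-distribˡ-+ (n C X) (X C j) _ ⟩
      (n C X) * (X C j) + (n C X) * (X C suc j)     ≡⟨ +-comm ((n C X) * (X C j)) _ ⟩
      trinomialTerm n m (suc j) + (n C X) * (X C j) ≡⟨ cong (λ Y → trinomialTerm n m (suc j) + (n C Y) * (Y C j)) (X≡ m j) ⟩
      trinomialTerm n m (suc j) + trinomialTerm n (2 + m) j ∎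
      where
      X = m + 2 * suc j
      X≡ : ∀ m j → m + 2 * suc j ≡ 2 + m + 2 * j
      X≡ = ℕ-Ring.solve-∀
    g-sum : sumTo (suc n) g ≡ trinomialSum n m + trinomialSum n (2 + m)
    g-sum = begin
      sumTo (suc n) g
        ≡⟨ sumTo-head n g ⟩
      g 0 + sumTo n (g ∘ suc)
        ≡⟨ cong (_+_ (g 0)) (trans (sumTo-cong n g-suc) (sumTo-+ n _ (trinomialTerm n (2 + m)))) ⟩
      g 0 + (sumTo n (trinomialTerm n m ∘ suc) + trinomialSum n (2 + m))
        ≡⟨ +-assoc (g 0) _ _ ⟨
      trinomialTerm n m 0 + sumTo n (trinomialTerm n m ∘ suc) + trinomialSum n (2 + m)
        ≡⟨ cong (_+ trinomialSum n (2 + m)) (trans (sym (sumTo-head n _)) (trinomialSum-suc n m)) ⟩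
      trinomialSum n m + trinomialSum n (2 + m) ∎

  central-binomial-pascal : ∀ j → suc (suc (2 * j)) C suc j ≡ 2 * (suc (2 * j) C j)
  central-binomial-pascal j = begin
    suc Y C suc j          ≡⟨ pascal Y j ⟩
    Y C j + Y C suc j      ≡⟨ cong (_+_ (Y C j)) (nCk≡nC[n∸k] (s≤s (m≤m+n j (j + 0)))) ⟩
    Y C j + Y C (2 * j ∸ j) ≡⟨ cong (λ k → Y C j + Y C k) (trans (m+n∸m≡n j (j + 0)) (+-identityʳ j)) ⟩
    Y C j + Y C j          ≡⟨ cong (_+_ (Y C j)) (+-identityʳ (Y C j)) ⟨
    2 * (Y C j)            ∎
    where
    open ≡-Reasoning
    Y = suc (2 * j)

  trinomialSum-pascal₀ : ∀ n → trinomialSum (suc n) 0 ≡ trinomialSum n 1 + trinomialSum n 0 + trinomialSum n 1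
  trinomialSum-pascal₀ n = begin
    trinomialSum (suc n) 0
      ≡⟨ sumTo-head n (trinomialTerm (suc n) 0) ⟩
    1 + sumTo n (trinomialTerm (suc n) 0 ∘ suc)
      ≡⟨ cong (_+_ 1) (trans (sumTo-cong n term-suc) (sumTo-+ n (trinomialTerm n 0 ∘ suc) _)) ⟩
    1 + (sumTo n (trinomialTerm n 0 ∘ suc) + sumTo n (λ j → 2 * trinomialTerm n 1 j))
      ≡⟨ +-assoc 1 (sumTo n (trinomialTerm n 0 ∘ suc)) _ ⟨
    1 + sumTo n (trinomialTerm n 0 ∘ suc) + sumTo n (λ j → 2 * trinomialTerm n 1 j)
      ≡⟨ cong₂ _+_ (trans (sym (sumTo-head n _)) (trinomialSum-suc n 0)) (sumTo-* n 2 (trinomialTerm n 1)) ⟩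
    trinomialSum n 0 + 2 * trinomialSum n 1
      ≡⟨ spread (trinomialSum n 0) (trinomialSum n 1) ⟩
    trinomialSum n 1 + trinomialSum n 0 + trinomialSum n 1 ∎
    where
    open ≡-Reasoning
    term-suc : ∀ j → trinomialTerm (suc n) 0 (suc j) ≡ trinomialTerm n 0 (suc j) + 2 * trinomialTerm n 1 j
    term-suc j = begin
      (suc n C (2 * suc j)) * ((2 * suc j) C suc j)
        ≡⟨ cong (λ Z → (suc n C Z) * (Z C suc j)) (Z≡ j) ⟩
      (suc n C suc Y) * (suc Y C suc j)
        ≡⟨ cong₂ _*_ (pascal n Y) (central-binomial-pascal j) ⟩
      (n C Y + n C suc Y) * (2 * (Y C j))
        ≡⟨ regroup (n C Y) (n C suc Y) (Y C j) ⟩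
      (n C suc Y) * (2 * (Y C j)) + 2 * ((n C Y) * (Y C j))
        ≡⟨ cong (λ c → (n C suc Y) * c + 2 * ((n C Y) * (Y C j))) (central-binomial-pascal j) ⟨
      (n C suc Y) * (suc Y C suc j) + 2 * ((n C Y) * (Y C j))
        ≡⟨ cong (λ Z → (n C Z) * (Z C suc j) + 2 * ((n C Y) * (Y C j))) (Z≡ j) ⟨
      trinomialTerm n 0 (suc j) + 2 * trinomialTerm n 1 j ∎
      where
      Y = suc (2 * j)
      Z≡ : ∀ j → 2 * suc j ≡ suc (suc (2 * j))
      Z≡ = ℕ-Ring.solve-∀
      regroup : ∀ a b c → (a + b) * (2 * c) ≡ b * (2 * c) + 2 * (a * c)
      regroup = ℕ-Ring.solve-∀
    spread : ∀ a b → a + 2 * b ≡ b + a + b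
    spread = ℕ-Ring.solve-∀

  pos-+₃ : ∀ a b c → + (a + b + c) ≡ + a ℤ.+ + b ℤ.+ + c
  pos-+₃ a b c = trans (ℤ.pos-+ (a + b) c) (cong (ℤ._+ + c) (ℤ.pos-+ a b))

  tri-padding : ∀ n {i} → i ≤ 1 → tri n i ≡ + 0
  tri-padding n z≤n       = refl
  tri-padding n (s≤s z≤n) = refl

  trinomialSum≡tri : ∀ n m → + trinomialSum n m ≡ tri n (2 + n ∸ m)
  trinomialSum≡tri zero    0             = refl
  trinomialSum≡tri zero    1             = refl
  trinomialSum≡tri zero    (suc (suc m)) = cong (tri 0) (sym (0∸n≡0 m))
  trinomialSum≡tri (suc n) zero          = begin
    + trinomialSum (suc n) 0
      ≡⟨ cong +_ (trinomialSum-pascal₀ n) ⟩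
    + (trinomialSum n 1 + trinomialSum n 0 + trinomialSum n 1)
      ≡⟨ pos-+₃ (trinomialSum n 1) (trinomialSum n 0) (trinomialSum n 1) ⟩
    + trinomialSum n 1 ℤ.+ + trinomialSum n 0 ℤ.+ + trinomialSum n 1
      ≡⟨ cong₂ ℤ._+_ (cong₂ ℤ._+_ (trinomialSum≡tri n 1) (trinomialSum≡tri n 0)) (trinomialSum≡tri n 1) ⟩
    tri n (1 + n) ℤ.+ central n ℤ.+ tri n (1 + n)
      ≡⟨ central-suc n ⟨
    central (suc n) ∎
    where open ≡-Reasoning
  trinomialSum≡tri (suc n) (suc m) with m ≤? n
  ... | yes m≤n = begin
    + trinomialSum (suc n) (suc m)
      ≡⟨ cong +_ (trinomialSum-pascal n m) ⟩
    + (trinomialSum n m + trinomialSum n (suc m) + trinomialSum n (2 + m))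
      ≡⟨ pos-+₃ (trinomialSum n m) (trinomialSum n (suc m)) (trinomialSum n (2 + m)) ⟩
    + trinomialSum n m ℤ.+ + trinomialSum n (suc m) ℤ.+ + trinomialSum n (2 + m)
      ≡⟨ cong₂ ℤ._+_ (cong₂ ℤ._+_ (trinomialSum≡tri n m) (trinomialSum≡tri n (suc m))) (trinomialSum≡tri n (2 + m)) ⟩
    tri n (2 + n ∸ m) ℤ.+ tri n (1 + n ∸ m) ℤ.+ tri n (n ∸ m)
      ≡⟨ cong₂ (λ i j → tri n i ℤ.+ tri n j ℤ.+ tri n (n ∸ m)) (+-∸-assoc 2 m≤n) (+-∸-assoc 1 m≤n) ⟩
    tri (suc n) (2 + (n ∸ m))
      ≡⟨ cong (tri (suc n)) (+-∸-assoc 2 m≤n) ⟨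
    tri (suc n) (2 + n ∸ m) ∎
    where open ≡-Reasoning
  ... | no m≰n = trans (cong +_ (trinomialSum-vanish (s≤s n<m))) (sym (tri-padding (suc n) (begin
    2 + n ∸ m       ≤⟨ ∸-monoʳ-≤ (2 + n) n<m ⟩
    2 + n ∸ suc n   ≡⟨ m+n∸n≡m 1 n ⟩
    1               ∎)))
    where
    open ≤-Reasoning
    n<m = ≰⇒> m≰n

  T≡trinomialSum : ∀ n → T n ≡ trinomialSum n 0
  T≡trinomialSum n = begin
    T n                                            ≡⟨ sumTo-extend (n ∸ n / 2) (n / 2) (trinomialTerm n 0) vanish ⟨
    sumTo (n ∸ n / 2 + n / 2) (trinomialTerm n 0)  ≡⟨ cong (λ k → sumTo k (trinomialTerm n 0)) (m∸n+n≡m (m/n≤m n 2)) ⟩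
    trinomialSum n 0                               ∎
    where
    open ≡-Reasoning
    vanish : ∀ j → n / 2 < j → trinomialTerm n 0 j ≡ 0
    vanish j n/2<j = trinomialTerm-vanish 0 j (≰⇒> λ 2j≤n →
      <⇒≱ n/2<j (subst (_≤ n / 2) (m*n/n≡m j 2) (/-monoˡ-≤ 2 (subst (_≤ n) (*-comm 2 j) 2j≤n))))

  T≡central : ∀ n → + T n ≡ central n
  T≡central n = trans (cong +_ (T≡trinomialSum n)) (trinomialSum≡tri n 0)

module Telescoping where
  open import Data.Nat as ℕ using (ℕ; zero; suc)
  import Data.Nat.Properties as ℕ
  open import Data.Integer using (ℤ; +_; -_; _+_; _-_; _*_)
  open import Data.Integer.Properties using (pos-+; pos-*; *-distribˡ-+)
  open import Data.Integer.Divisibility.Signed using (_∣_; divides)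
  open import Data.Integer.Tactic.RingSolver using (solve-∀)
  open import Relation.Binary.PropositionalEquality using (_≡_; refl; sym; trans; cong; cong₂; subst₂; module ≡-Reasoning)
  open Trinomial using (central; central-recurrence)
  open CentralTrinomialSum using (T≡central)

  Q : ℤ → ℤ → ℤ → ℤ
  Q n X Y = - ((+ 2 * n - + 5) * (+ 2 * n - + 5) * X * X) + (+ 24 * n * n + + 120 * n - + 126) * X * Y
            - + 9 * ((+ 2 * n - + 3) * (+ 2 * n - + 3)) * Y * Y
  {-# INLINE Q #-}

  Q-telescopes : ∀ m a b → let u = (+ 3 + + 2 * m) * a + + 3 * (+ 1 + m) * b in
    Q (+ 1 + m) ((+ 1 + m) * a) ((+ 1 + m) * b) + + 24 * ((+ 1 + m) * (+ 17 + + 8 * m) * a * u)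
      ≡ Q (+ 2 + m) u ((+ 2 + m) * a)
  Q-telescopes = solve-∀

  summand : ℕ → ℕ
  summand k = k ℕ.* (k ℕ.+ 1) ℕ.* (8 ℕ.* k ℕ.+ 9) ℕ.* T k ℕ.* T (k ℕ.+ 1)

  pos-weight : ∀ k → + (k ℕ.* (k ℕ.+ 1) ℕ.* (8 ℕ.* k ℕ.+ 9)) ≡ + k * (+ k + + 1) * (+ 8 * + k + + 9)
  pos-weight k = begin
    + (k ℕ.* (k ℕ.+ 1) ℕ.* (8 ℕ.* k ℕ.+ 9))        ≡⟨ pos-* (k ℕ.* (k ℕ.+ 1)) (8 ℕ.* k ℕ.+ 9) ⟩
    + (k ℕ.* (k ℕ.+ 1)) * + (8 ℕ.* k ℕ.+ 9)        ≡⟨ cong₂ _*_ (trans (pos-* k (k ℕ.+ 1)) (cong (+ k *_) (pos-+ k 1)))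
                                                                  (trans (pos-+ (8 ℕ.* k) 9) (cong (_+ + 9) (pos-* 8 k))) ⟩
    + k * (+ k + + 1) * (+ 8 * + k + + 9)          ∎
    where open ≡-Reasoning

  summand-suc : ∀ m → + summand (suc m) ≡ (+ 1 + + m) * (+ 17 + + 8 * + m) * central (1 ℕ.+ m) * (+ (2 ℕ.+ m) * central (2 ℕ.+ m))
  summand-suc m = begin
    + summand (suc m)
      ≡⟨ trans (pos-* (w ℕ.* T (suc m)) (T (suc m ℕ.+ 1))) (cong (_* + T (suc m ℕ.+ 1)) (pos-* w (T (suc m)))) ⟩
    + w * + T (suc m) * + T (suc m ℕ.+ 1)
      ≡⟨ cong₂ (λ c d → + w * c * d) (T≡central (suc m)) (trans (cong (λ k → + T k) (ℕ.+-comm (suc m) 1)) (T≡central (2 ℕ.+ m))) ⟩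
    + w * central (1 ℕ.+ m) * central (2 ℕ.+ m)
      ≡⟨ cong (λ c → c * central (1 ℕ.+ m) * central (2 ℕ.+ m)) (pos-weight (suc m)) ⟩
    (+ 1 + + m) * (+ 1 + + m + + 1) * (+ 8 * (+ 1 + + m) + + 9) * central (1 ℕ.+ m) * central (2 ℕ.+ m)
      ≡⟨ regroup (+ m) (central (1 ℕ.+ m)) (central (2 ℕ.+ m)) ⟩
    (+ 1 + + m) * (+ 17 + + 8 * + m) * central (1 ℕ.+ m) * (+ (2 ℕ.+ m) * central (2 ℕ.+ m)) ∎
    where
    open ≡-Reasoning
    w = suc m ℕ.* (suc m ℕ.+ 1) ℕ.* (8 ℕ.* suc m ℕ.+ 9)
    regroup : ∀ m a b → (+ 1 + m) * (+ 1 + m + + 1) * (+ 8 * (+ 1 + m) + + 9) * a * b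
      ≡ (+ 1 + m) * (+ 17 + + 8 * m) * a * ((+ 2 + m) * b)
    regroup = solve-∀

  sum-closed-form : ∀ m → + 24 * + sumTo m summand
    ≡ Q (+ 1 + + m) ((+ 1 + + m) * central (1 ℕ.+ m)) ((+ 1 + + m) * central m)
  sum-closed-form zero    = refl
  sum-closed-form (suc m) = begin
    + 24 * + (sumTo m summand ℕ.+ summand (suc m))
      ≡⟨ trans (cong (+ 24 *_) (pos-+ (sumTo m summand) (summand (suc m)))) (*-distribˡ-+ (+ 24) (+ sumTo m summand) (+ summand (suc m))) ⟩
    + 24 * + sumTo m summand + + 24 * + summand (suc m)
      ≡⟨ cong₂ (λ s t → s + + 24 * t) (sum-closed-form m) (summand-suc m) ⟩
    Q (+ 1 + + m) ((+ 1 + + m) * a) ((+ 1 + + m) * b) + + 24 * ((+ 1 + + m) * (+ 17 + + 8 * + m) * a * (+ (2 ℕ.+ m) * c))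
      ≡⟨ cong (λ u → Q (+ 1 + + m) ((+ 1 + + m) * a) ((+ 1 + + m) * b) + + 24 * ((+ 1 + + m) * (+ 17 + + 8 * + m) * a * u))
              (central-recurrence m) ⟩
    Q (+ 1 + + m) ((+ 1 + + m) * a) ((+ 1 + + m) * b) + + 24 * ((+ 1 + + m) * (+ 17 + + 8 * + m) * a * u)
      ≡⟨ Q-telescopes (+ m) a b ⟩
    Q (+ 2 + + m) u ((+ 2 + + m) * a)
      ≡⟨ cong (λ u → Q (+ 2 + + m) u ((+ 2 + + m) * a)) (central-recurrence m) ⟨
    Q (+ 2 + + m) ((+ 2 + + m) * c) ((+ 2 + + m) * a) ∎
    where
    open ≡-Reasoning
    a = central (1 ℕ.+ m)
    b = central m
    c = central (2 ℕ.+ m)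
    u = (+ 3 + + 2 * + m) * a + + 3 * + (1 ℕ.+ m) * b

  i-j≡k⇒i≡j+k : ∀ {i j k} → i - j ≡ k → i ≡ j + k
  i-j≡k⇒i≡j+k {i} {j} refl = shift i j
    where
    shift : ∀ i j → i ≡ j + (i - j)
    shift = solve-∀

  Q-mod-cube : ∀ n ε {X Y} → n ∣ X - + 1 → n ∣ Y - ε →
    n * n * n ∣ Q n (n * X) (n * Y) - n * n * Q (+ 0) (+ 1) ε
  Q-mod-cube n ε (divides u X-1≡) (divides v Y-ε≡) =
    subst₂ (λ X Y → n * n * n ∣ Q n (n * X) (n * Y) - n * n * Q (+ 0) (+ 1) ε)
      (sym (i-j≡k⇒i≡j+k X-1≡)) (sym (i-j≡k⇒i≡j+k Y-ε≡)) (divides (remainder n ε u v) (expansion n ε u v))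
    where
    remainder : ℤ → ℤ → ℤ → ℤ → ℤ
    remainder n ε u v = let X = + 1 + u * n; Y = ε + v * n in
      (+ 20 - + 4 * n) * X * X + (+ 24 * n + + 120) * X * Y + (+ 108 - + 36 * n) * Y * Y
      - + 50 * u - + 126 * (ε * u + v) - + 162 * ε * v - n * (+ 25 * u * u + + 126 * u * v + + 81 * v * v)
    {-# INLINE remainder #-}
    expansion : ∀ n ε u v → Q n (n * (+ 1 + u * n)) (n * (ε + v * n)) - n * n * Q (+ 0) (+ 1) ε
      ≡ remainder n ε u v * (n * n * n)
    expansion = solve-∀

module RationalCongruence where
  open import Data.Nat as ℕ using (_^_)
  import Data.Nat.Properties as ℕ
  open import Data.Nat.Divisibility using (_∣_)
  open import Data.Integer as ℤ using (+_)
  import Data.Integer.Properties as ℤ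
  open import Data.Integer.Divisibility.Signed as ℤ using (divides)
  open import Data.Integer.Tactic.RingSolver using (solve-∀)
  open import Data.Rational as ℚ using (ℚ)
  import Data.Rational.Properties as ℚ
  open import Data.Rational.Unnormalised as ℚᵘ using (mkℚᵘ; *≡*)
  import Data.Rational.Unnormalised.Properties as ℚᵘ
  open import Data.Product using (_,_)
  open import Relation.Nullary using (¬_)
  open import Relation.Binary.PropositionalEquality using (_≡_; sym; trans; cong; cong₂; module ≡-Reasoning)

  toℚᵘ-toℚ : ∀ z → ℚ.toℚᵘ (toℚ z) ℚᵘ.≃ mkℚᵘ z 0
  toℚᵘ-toℚ z = ℚ.toℚᵘ-fromℚᵘ (mkℚᵘ z 0)

  toℚ-+ : ∀ x y → toℚ (x ℤ.+ y) ≡ toℚ x ℚ.+ toℚ y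
  toℚ-+ x y = ℚ.toℚᵘ-injective (ℚᵘ.≃-trans (toℚᵘ-toℚ (x ℤ.+ y)) (ℚᵘ.≃-sym
    (ℚᵘ.≃-trans (ℚ.toℚᵘ-homo-+ (toℚ x) (toℚ y)) (ℚᵘ.≃-trans (ℚᵘ.+-cong (toℚᵘ-toℚ x) (toℚᵘ-toℚ y)) (*≡* (identity x y))))))
    where
    identity : ∀ x y → (x ℤ.* + 1 ℤ.+ y ℤ.* + 1) ℤ.* + 1 ≡ (x ℤ.+ y) ℤ.* (+ 1 ℤ.* + 1)
    identity = solve-∀

  toℚ-* : ∀ x y → toℚ (x ℤ.* y) ≡ toℚ x ℚ.* toℚ y
  toℚ-* x y = ℚ.toℚᵘ-injective (ℚᵘ.≃-trans (toℚᵘ-toℚ (x ℤ.* y)) (ℚᵘ.≃-sym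
    (ℚᵘ.≃-trans (ℚ.toℚᵘ-homo-* (toℚ x) (toℚ y)) (ℚᵘ.≃-trans (ℚᵘ.*-cong (toℚᵘ-toℚ x) (toℚᵘ-toℚ y)) (*≡* (identity x y))))))
    where
    identity : ∀ x y → (x ℤ.* y) ℤ.* + 1 ≡ (x ℤ.* y) ℤ.* (+ 1 ℤ.* + 1)
    identity = solve-∀

  toℚ-neg : ∀ x → toℚ (ℤ.- x) ≡ ℚ.- toℚ x
  toℚ-neg x = ℚ.toℚᵘ-injective (ℚᵘ.≃-trans (toℚᵘ-toℚ (ℤ.- x)) (ℚᵘ.≃-sym
    (ℚᵘ.≃-trans (ℚ.toℚᵘ-homo‿- (toℚ x)) (ℚᵘ.-‿cong (toℚᵘ-toℚ x)))))

  pos-square : ∀ m → + (m ^ 2) ≡ + m ℤ.* + m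
  pos-square m = trans (ℤ.pos-* m (m ℕ.* 1)) (cong (λ k → + m ℤ.* + k) (ℕ.*-identityʳ m))

  pos-cube : ∀ m → + (m ^ 3) ≡ + m ℤ.* + m ℤ.* + m
  pos-cube m = trans (ℤ.pos-* m (m ^ 2)) (trans (cong (+ m ℤ.*_) (pos-square m)) (sym (ℤ.*-assoc (+ m) (+ m) (+ m))))

  CongModP3-scaled : ∀ {p} b x {y′} {y : ℚ} → ¬ p ∣ b → toℚ (+ b) ℚ.* y ≡ toℚ y′ →
    + p ℤ.* + p ℤ.* + p ℤ.∣ + b ℤ.* x ℤ.- y′ → CongModP3 p (toℚ x) y
  CongModP3-scaled {p} b x {y′} {y} p∤b by≡y′ (divides a eq) = a , b , p∤b , (begin
    toℚ (+ b) ℚ.* (toℚ x ℚ.- y)                      ≡⟨ ℚ.*-distribˡ-+ (toℚ (+ b)) (toℚ x) (ℚ.- y) ⟩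
    toℚ (+ b) ℚ.* toℚ x ℚ.+ toℚ (+ b) ℚ.* (ℚ.- y)    ≡⟨ cong₂ ℚ._+_ (toℚ-* (+ b) x) (ℚ.neg-distribʳ-* (toℚ (+ b)) y) ⟨
    toℚ (+ b ℤ.* x) ℚ.+ ℚ.- (toℚ (+ b) ℚ.* y)        ≡⟨ cong (λ z → toℚ (+ b ℤ.* x) ℚ.+ ℚ.- z) by≡y′ ⟩
    toℚ (+ b ℤ.* x) ℚ.+ ℚ.- toℚ y′                   ≡⟨ cong (toℚ (+ b ℤ.* x) ℚ.+_) (toℚ-neg y′) ⟨
    toℚ (+ b ℤ.* x) ℚ.+ toℚ (ℤ.- y′)                 ≡⟨ toℚ-+ (+ b ℤ.* x) (ℤ.- y′) ⟨
    toℚ (+ b ℤ.* x ℤ.- y′)                           ≡⟨ cong toℚ (trans eq (ℤ.*-comm a _)) ⟩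
    toℚ ((+ p ℤ.* + p ℤ.* + p) ℤ.* a)                ≡⟨ cong (λ c → toℚ (c ℤ.* a)) (pos-cube p) ⟨
    toℚ (+ (p ^ 3) ℤ.* a)                            ∎)
    where open ≡-Reasoning

open import Data.Nat using (ℕ; suc; _+_; _*_; _^_; _>_; _∸_; _%_; _<_; s≤s)
import Data.Nat.Properties as ℕ
open import Data.Nat.Divisibility using (_∣_; >⇒∤; m%n≡0⇒n∣m)
open import Data.Nat.DivMod using (m%n<n)
open import Data.Nat.Primality using (Prime; euclidsLemma; composite)
open import Data.Integer as ℤ using (+_; -[1+_])
import Data.Integer.Divisibility.Signed as ℤ
open import Data.Integer.Tactic.RingSolver using (solve-∀)
import Data.Rational as ℚ
open import Data.Rational.Solver using (module +-*-Solver)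
open import Data.Product using (proj₁; proj₂)
open import Data.Sum using (_⊎_; inj₁; inj₂; [_,_]′)
open import Relation.Nullary using (¬_; contradiction)
open import Relation.Binary.PropositionalEquality using (_≡_; refl; sym; trans; cong; subst; module ≡-Reasoning)
open Trinomial using (central)
open TrinomialModPrime using (χ-legendre3; p∣central[p]-χ; p∣central[p-1]-χ)
open Telescoping using (Q; summand; sum-closed-form; Q-mod-cube)
open RationalCongruence using (toℚ-*; toℚ-neg; pos-square; CongModP3-scaled)

prime>3⇒residue : ∀ {p} → Prime p → 3 < p → p % 3 ≡ 1 ⊎ p % 3 ≡ 2
prime>3⇒residue {p} prime-p 3<p with p % 3 in p%3≡ | m%n<n p 3
... | 0                     | _ = contradiction (composite 3<p (m%n≡0⇒n∣m p 3 p%3≡)) (Prime.notComposite prime-p)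
... | 1                     | _ = inj₁ refl
... | 2                     | _ = inj₂ refl
... | suc (suc (suc _))     | s≤s (s≤s (s≤s ()))

prime∤* : ∀ {p m n} → Prime p → ¬ p ∣ m → ¬ p ∣ n → ¬ p ∣ m * n
prime∤* {m = m} {n} prime-p p∤m p∤n p∣mn = [ p∤m , p∤n ]′ (euclidsLemma m n prime-p p∣mn)

prime>3∤24 : ∀ {p} → Prime p → 3 < p → ¬ p ∣ 24
prime>3∤24 prime-p 3<p = prime∤* prime-p ∤2 (prime∤* prime-p ∤2 (prime∤* prime-p ∤2 (>⇒∤ 3<p)))
  where
  ∤2 = >⇒∤ (ℕ.<-trans (ℕ.n<1+n 2) 3<p)

legendre3-unit : ∀ {p} → p % 3 ≡ 1 ⊎ p % 3 ≡ 2 → legendre3 p ≡ + 1 ⊎ legendre3 p ≡ -[1+ 0 ]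
legendre3-unit (inj₁ p%3≡1) rewrite p%3≡1 = inj₁ refl
legendre3-unit (inj₂ p%3≡2) rewrite p%3≡2 = inj₂ refl

scaled-rhs : ∀ p {ε} → ε ≡ + 1 ⊎ ε ≡ -[1+ 0 ] →
  toℚ (+ 24) ℚ.* ℚ.- (toℚ (+ (p ^ 2)) ℚ.* ((+ 53) ℚ./ 12 ℚ.+ ((+ 21) ℚ./ 4) ℚ.* toℚ ε))
    ≡ toℚ (+ p ℤ.* + p ℤ.* Q (+ 0) (+ 1) ε)
scaled-rhs p {ε} ε-unit = begin
  toℚ (+ 24) ℚ.* ℚ.- (toℚ (+ (p ^ 2)) ℚ.* K)     ≡⟨ pull (toℚ (+ 24)) (toℚ (+ (p ^ 2))) K ⟩
  ℚ.- (toℚ (+ (p ^ 2)) ℚ.* (toℚ (+ 24) ℚ.* K))   ≡⟨ cong (λ c → ℚ.- (toℚ (+ (p ^ 2)) ℚ.* c)) (24K ε-unit) ⟩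
  ℚ.- (toℚ (+ (p ^ 2)) ℚ.* toℚ (ℤ.- Q₀))         ≡⟨ cong ℚ.-_ (toℚ-* (+ (p ^ 2)) (ℤ.- Q₀)) ⟨
  ℚ.- toℚ (+ (p ^ 2) ℤ.* ℤ.- Q₀)                 ≡⟨ toℚ-neg (+ (p ^ 2) ℤ.* ℤ.- Q₀) ⟨
  toℚ (ℤ.- (+ (p ^ 2) ℤ.* ℤ.- Q₀))               ≡⟨ cong toℚ (trans (neg-neg (+ (p ^ 2)) Q₀) (cong (ℤ._* Q₀) (pos-square p))) ⟩
  toℚ (+ p ℤ.* + p ℤ.* Q₀)                       ∎
  where
  open ≡-Reasoning
  open +-*-Solver
  K = (+ 53) ℚ./ 12 ℚ.+ ((+ 21) ℚ./ 4) ℚ.* toℚ ε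
  Q₀ = Q (+ 0) (+ 1) ε
  pull : ∀ b m K → b ℚ.* ℚ.- (m ℚ.* K) ≡ ℚ.- (m ℚ.* (b ℚ.* K))
  pull = solve 3 (λ b m K → b :* (:- (m :* K)) := :- (m :* (b :* K))) refl
  24K : ∀ {ε} → ε ≡ + 1 ⊎ ε ≡ -[1+ 0 ] → toℚ (+ 24) ℚ.* ((+ 53) ℚ./ 12 ℚ.+ ((+ 21) ℚ./ 4) ℚ.* toℚ ε) ≡ toℚ (ℤ.- Q (+ 0) (+ 1) ε)
  24K (inj₁ refl) = refl
  24K (inj₂ refl) = refl
  neg-neg : ∀ m q → ℤ.- (m ℤ.* ℤ.- q) ≡ m ℤ.* q
  neg-neg = solve-∀

theorem1p2 : (p : ℕ) → Prime p → p > 3 →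
    CongModP3 p
      (toℚ (+ sumTo (p ∸ 1) (λ k → k * (k + 1) * (8 * k + 9) * T k * T (k + 1))))
      (ℚ.- (toℚ (+ (p ^ 2)) ℚ.* ((+ 53) ℚ./ 12 ℚ.+ ((+ 21) ℚ./ 4) ℚ.* toℚ (legendre3 p))))
theorem1p2 (suc N) prime-p p>3 =
  CongModP3-scaled 24 (+ sumTo N summand) (prime>3∤24 prime-p p>3) (scaled-rhs p (legendre3-unit {p} residue))
    (subst (λ s → P ℤ.* P ℤ.* P ℤ.∣ s ℤ.- P ℤ.* P ℤ.* Q (+ 0) (+ 1) ε) (sym (sum-closed-form N))
      (Q-mod-cube P ε Tₚ≡1 Tₚ₋₁≡ε))
  where
  p = suc N
  P = + p
  ε = legendre3 p
  residue = prime>3⇒residue prime-p p>3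
  Tₚ≡1 : P ℤ.∣ central p ℤ.- + 1
  Tₚ≡1 = subst (λ c → P ℤ.∣ central p ℤ.- c) (proj₂ (χ-legendre3 p residue)) (p∣central[p]-χ prime-p)
  Tₚ₋₁≡ε : P ℤ.∣ central N ℤ.- ε
  Tₚ₋₁≡ε = subst (λ c → P ℤ.∣ central N ℤ.- c) (proj₁ (χ-legendre3 p residue)) (p∣central[p-1]-χ prime-p)
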